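{- For all integers $d\ge 1$ and $n\ge 0$ there is a bijection between the set $S_{d,n}$ of Schröder paths of length $2n$ whose up-steps are each colored by a color from $\{1,\dots,d-1\}$, and the set $T_{d,n}$ of binary trees with $n$ vertices, each vertex colored by a color from $\{0,1,\dots,d-1\}$, such that no vertex has a right child of the same color.
   Context: A Schröder path of length $2n$ is a lattice path from $(0,0)$ to $(2n,0)$ using up-steps $(1,1)$, down-steps $(1,-1)$ and level-steps $(2,0)$, never going below the $x$-axis. Binary trees are rooted, ordered, and each child is either a left or a right child; the empty tree has $0$ vertices. -}

module Defs where

open import Data.Nat using (ℕ; zero; suc; _+_; _∸_; _*_; _≡ᵇ_)
open import Data.Fin using (Fin; _≟_)
open import Data.Bool using (Bool; true; false; _∧_; not)
open import Data.List using (List; []; _∷_)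
open import Data.Product using (Σ; _×_)
open import Relation.Binary.PropositionalEquality using (_≡_)
open import Relation.Nullary.Decidable using (⌊_⌋)

data Step (C : Set) : Set where
  up    : C → Step C
  down  : Step C
  level : Step C

width : {C : Set} → List (Step C) → ℕ
width []            = 0
width (up _ ∷ s)    = suc (width s)
width (down ∷ s)    = suc (width s)
width (level ∷ s)   = 2 + width s

staysAboveFrom : {C : Set} → ℕ → List (Step C) → Bool
staysAboveFrom h []            = h ≡ᵇ 0
staysAboveFrom h (up _ ∷ s)    = staysAboveFrom (suc h) s
staysAboveFrom zero (down ∷ s) = false
staysAboveFrom (suc h) (down ∷ s) = staysAboveFrom h s
staysAboveFrom h (level ∷ s)   = staysAboveFrom h s

SchroderPath : (C : Set) → ℕ → Set
SchroderPath C n = Σ (List (Step C)) (λ s → (width s ≡ 2 * n) × (staysAboveFrom 0 s ≡ true))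


-- S_{d,n}: colours {1,…,d-1} represented by Fin (d ∸ 1)
S : ℕ → ℕ → Set
S d n = SchroderPath (Fin (d ∸ 1)) n

-- binary trees with vertices labelled by A (leaf = empty tree)
data BTree (A : Set) : Set where
  leaf : BTree A
  node : BTree A → A → BTree A → BTree A

size : {A : Set} → BTree A → ℕ
size leaf         = 0
size (node l _ r) = suc (size l + size r)

rootDiffers : {d : ℕ} → Fin d → BTree (Fin d) → Bool
rootDiffers c leaf         = true
rootDiffers c (node _ c' _) = not ⌊ c ≟ c' ⌋

noSameRight : {d : ℕ} → BTree (Fin d) → Bool
noSameRight leaf         = true
noSameRight (node l c r) = rootDiffers c r ∧ noSameRight l ∧ noSameRight r

T : ℕ → ℕ → Set
T d n = Σ (BTree (Fin d)) (λ t → (size t ≡ n) × (noSameRight t ≡ true))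

-- A Schröder path is built from the empty path by prefixing a level step, or by
-- the first-return decomposition  up · p · down · q;  a tree is built from leaves
-- by  node l c r.  Both grammars are read off the same recursion: a level step
-- becomes a vertex of colour 0 with no right child, and  up k · p · down · q
-- becomes a vertex with left subtree p and right subtree q whose colour is k,
-- renumbered to skip the colour of the right child's root (colour 0 when there is
-- no right child).  The skipped colour is exactly the forbidden one, and colour 0
-- without right child is the only colour left over, which is the level step.
module Submission where

open import Defs
open import Data.Bool using (Bool; true)
open import Data.Bool.Properties using (∧-conicalˡ; ∧-conicalʳ)
import Data.Bool.Properties as Bool
open import Data.Empty using (⊥-elim)
open import Data.Fin using (Fin; zero; suc; punchIn; punchOut; _≟_)
open import Data.Fin.Properties using (punchInᵢ≢i; punchIn-punchOut; punchOut-punchIn; punchOut-cong)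
open import Data.List using (List; []; _∷_; _++_)
open import Data.List.Properties using (++-assoc; ++-identityʳ)
open import Data.Nat using (ℕ; zero; suc; _+_; _*_; _≥_)
import Data.Nat.Properties as ℕ
open import Data.Nat.Tactic.RingSolver using (solve-∀)
open import Data.Product using (Σ; _×_; _,_; proj₁)
open import Data.Vec using (Vec; []; _∷_; head; replicate; _[_]%=_)
open import Function.Base using (_∘_)
open import Function.Bundles using (_⤖_; _↔_; mk↔ₛ′)
open import Function.Properties.Inverse using (↔-trans; ↔⇒⤖)
open import Axiom.UniquenessOfIdentityProofs using (module Decidable⇒UIP)
open import Relation.Binary.PropositionalEquality
open ≡-Reasoning
open import Relation.Nullary using (Irrelevant; yes; no)

private
  variable
    A C : Set
    P : A → Set
    e : ℕ

proj₁-injective : (∀ {a} → Irrelevant (P a)) → {x y : Σ A P} → proj₁ x ≡ proj₁ y → x ≡ y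
proj₁-injective irr {a , p} {_ , q} refl = cong (a ,_) (irr p q)

≡×≡-irrelevant : {m n : ℕ} {b c : Bool} → Irrelevant ((m ≡ n) × (b ≡ c))
≡×≡-irrelevant (p , q) (p′ , q′) =
  cong₂ _,_ (ℕ.≡-irrelevant p p′) (Decidable⇒UIP.≡-irrelevant Bool._≟_ q q′)

data Schröder (C : Set) : Set where
  ε    : Schröder C
  flat : Schröder C → Schröder C
  lift : C → Schröder C → Schröder C → Schröder C

semilength : Schröder C → ℕ
semilength ε            = 0
semilength (flat p)     = suc (semilength p)
semilength (lift _ p q) = suc (semilength p + semilength q)

_++ₛ_ : Schröder C → Schröder C → Schröder C
ε          ++ₛ q = q
flat p     ++ₛ q = flat (p ++ₛ q)
lift k p r ++ₛ q = lift k p (r ++ₛ q)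

++ₛ-identityʳ : (p : Schröder C) → p ++ₛ ε ≡ p
++ₛ-identityʳ ε            = refl
++ₛ-identityʳ (flat p)     = cong flat (++ₛ-identityʳ p)
++ₛ-identityʳ (lift k p q) = cong (lift k p) (++ₛ-identityʳ q)

encode : Schröder C → List (Step C)
encode ε            = []
encode (flat p)     = level ∷ encode p
encode (lift k p q) = up k ∷ encode p ++ down ∷ encode q

width-++ : ∀ (s t : List (Step C)) → width (s ++ t) ≡ width s + width t
width-++ []          t = refl
width-++ (up _ ∷ s)  t = cong suc (width-++ s t)
width-++ (down ∷ s)  t = cong suc (width-++ s t)
width-++ (level ∷ s) t = cong (2 +_) (width-++ s t)

width-encode : (p : Schröder C) → width (encode p) ≡ 2 * semilength p
width-encode ε        = refl
width-encode (flat p) = begin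
  2 + width (encode p)   ≡⟨ cong (2 +_) (width-encode p) ⟩
  2 + 2 * semilength p   ≡⟨ ℕ.*-distribˡ-+ 2 1 (semilength p) ⟨
  2 * semilength (flat p) ∎
width-encode (lift k p q) = begin
  suc (width (encode p ++ down ∷ encode q))
    ≡⟨ cong suc (width-++ (encode p) (down ∷ encode q)) ⟩
  suc (width (encode p) + suc (width (encode q)))
    ≡⟨ cong₂ (λ a b → suc (a + suc b)) (width-encode p) (width-encode q) ⟩
  suc (2 * semilength p + suc (2 * semilength q))
    ≡⟨ 1+2a+1+2b≡2[1+a+b] (semilength p) (semilength q) ⟩
  2 * semilength (lift k p q) ∎
  where
  1+2a+1+2b≡2[1+a+b] : ∀ a b → suc (2 * a + suc (2 * b)) ≡ 2 * suc (a + b)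
  1+2a+1+2b≡2[1+a+b] = solve-∀

staysAboveFrom-encode : ∀ h (p : Schröder C) t → staysAboveFrom h (encode p ++ t) ≡ staysAboveFrom h t
staysAboveFrom-encode h ε            t = refl
staysAboveFrom-encode h (flat p)     t = staysAboveFrom-encode h p t
staysAboveFrom-encode h (lift k p q) t = begin
  staysAboveFrom (suc h) ((encode p ++ down ∷ encode q) ++ t)
    ≡⟨ cong (staysAboveFrom (suc h)) (++-assoc (encode p) (down ∷ encode q) t) ⟩
  staysAboveFrom (suc h) (encode p ++ down ∷ encode q ++ t)
    ≡⟨ staysAboveFrom-encode (suc h) p (down ∷ encode q ++ t) ⟩
  staysAboveFrom h (encode q ++ t)
    ≡⟨ staysAboveFrom-encode h q t ⟩
  staysAboveFrom h t ∎

closeLift : ∀ {m} → C → Vec (Schröder C) (2 + m) → Vec (Schröder C) (1 + m)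
closeLift k (p ∷ q ∷ ps) = lift k p q ∷ ps

-- A suffix starting at height h is read as a stack of h + 1 pieces: the head is
-- the part before the suffix first drops below height h, the i-th entry of the
-- tail the part after the down-step to height h ∸ i.  Ill-formed input gives junk.
parse : (h : ℕ) → List (Step C) → Vec (Schröder C) (suc h)
parse h       []          = replicate _ ε
parse h       (level ∷ s) = parse h s [ zero ]%= flat
parse zero    (down ∷ s)  = ε ∷ []
parse (suc h) (down ∷ s)  = ε ∷ parse h s
parse h       (up k ∷ s)  = closeLift k (parse (suc h) s)

downs : ∀ {m} → Vec (Schröder C) m → List (Step C)
downs []       = []
downs (q ∷ qs) = down ∷ encode q ++ downs qs

unparse : ∀ {m} → Vec (Schröder C) (suc m) → List (Step C)
unparse (p ∷ ps) = encode p ++ downs ps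

parse-encode : ∀ h (p : Schröder C) t → parse h (encode p ++ t) ≡ parse h t [ zero ]%= (p ++ₛ_)
parse-encode h ε t with parse h t
... | _ ∷ _ = refl
parse-encode h (flat p) t rewrite parse-encode h p t with parse h t
... | _ ∷ _ = refl
parse-encode h (lift k p q) t
  rewrite ++-assoc (encode p) (down ∷ encode q) t
        | parse-encode (suc h) p (down ∷ encode q ++ t)
        | ++ₛ-identityʳ p
        | parse-encode h q t
  with parse h t
... | _ ∷ _ = refl

unparse-parse : ∀ h (s : List (Step C)) → staysAboveFrom h s ≡ true → unparse (parse h s) ≡ s
unparse-parse zero    []          _  = refl
unparse-parse h       (level ∷ s) ok with parse h s | unparse-parse h s ok
... | _ ∷ _ | ih = cong (level ∷_) ih
unparse-parse (suc h) (down ∷ s)  ok with parse h s | unparse-parse h s ok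
... | _ ∷ _ | ih = cong (down ∷_) ih
unparse-parse h       (up k ∷ s)  ok with parse (suc h) s | unparse-parse (suc h) s ok
... | p ∷ q ∷ ps | ih = cong (up k ∷_) (trans (++-assoc (encode p) (down ∷ encode q) (downs ps)) ih)

decode : List (Step C) → Schröder C
decode s = head (parse 0 s)

decode-encode : (p : Schröder C) → decode (encode p) ≡ p
decode-encode p = begin
  head (parse 0 (encode p))      ≡⟨ cong (head ∘ parse 0) (++-identityʳ (encode p)) ⟨
  head (parse 0 (encode p ++ [])) ≡⟨ cong head (parse-encode 0 p []) ⟩
  p ++ₛ ε                        ≡⟨ ++ₛ-identityʳ p ⟩
  p                              ∎

encode-decode : (s : List (Step C)) → staysAboveFrom 0 s ≡ true → encode (decode s) ≡ s
encode-decode s ok with parse 0 s | unparse-parse 0 s ok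
... | p ∷ [] | ih = trans (sym (++-identityʳ (encode p))) ih

SchroderPath↔Schröder : ∀ n → SchroderPath C n ↔ Σ (Schröder C) (λ p → semilength p ≡ n)
SchroderPath↔Schröder n = mk↔ₛ′ to from to∘from from∘to
  where
  to : SchroderPath C n → Σ (Schröder C) (λ p → semilength p ≡ n)
  to (s , w , ok) = decode s , ℕ.*-cancelˡ-≡ _ _ 2 (begin
    2 * semilength (decode s)  ≡⟨ width-encode (decode s) ⟨
    width (encode (decode s))  ≡⟨ cong width (encode-decode s ok) ⟩
    width s                    ≡⟨ w ⟩
    2 * n                      ∎)

  from : Σ (Schröder C) (λ p → semilength p ≡ n) → SchroderPath C n
  from (p , len) = encode p
                 , trans (width-encode p) (cong (2 *_) len)
                 , trans (cong (staysAboveFrom 0) (sym (++-identityʳ (encode p))))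
                         (staysAboveFrom-encode 0 p [])

  to∘from : ∀ x → to (from x) ≡ x
  to∘from (p , _) = proj₁-injective ℕ.≡-irrelevant (decode-encode p)

  from∘to : ∀ x → from (to x) ≡ x
  from∘to (s , _ , ok) =
    proj₁-injective ≡×≡-irrelevant (encode-decode s ok)

rootOr : A → BTree A → A
rootOr a leaf         = a
rootOr _ (node _ c _) = c

noSameRight-node⁻ : ∀ {d} (l : BTree (Fin d)) c r → noSameRight (node l c r) ≡ true →
                    rootDiffers c r ≡ true × noSameRight l ≡ true × noSameRight r ≡ true
noSameRight-node⁻ l c r ok =
  ∧-conicalˡ (rootDiffers c r) _ ok , ∧-conicalˡ (noSameRight l) _ rest , ∧-conicalʳ _ (noSameRight r) rest
  where
  rest = ∧-conicalʳ (rootDiffers c r) _ ok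

rootDiffers-punchIn : ∀ {d} (t : BTree (Fin (suc d))) j → rootDiffers (punchIn (rootOr zero t) j) t ≡ true
rootDiffers-punchIn leaf         j = refl
rootDiffers-punchIn (node _ c _) j with punchIn c j ≟ c
... | yes punchIn≡c = ⊥-elim (punchInᵢ≢i c j punchIn≡c)
... | no _     = refl

rootOr≡⇒leaf : ∀ {d} {c : Fin (suc d)} r → rootDiffers c r ≡ true → rootOr zero r ≡ c → r ≡ leaf × zero ≡ c
rootOr≡⇒leaf leaf _ 0≡c = refl , 0≡c
rootOr≡⇒leaf {c = c} (node _ _ _) _ refl with c ≟ c
rootOr≡⇒leaf (node _ _ _) () refl | yes _
rootOr≡⇒leaf (node _ _ _) _  refl | no c≢c = ⊥-elim (c≢c refl)

toTree : Schröder (Fin e) → BTree (Fin (suc e))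
toTree ε            = leaf
toTree (flat p)     = node (toTree p) zero leaf
toTree (lift k p q) = node (toTree p) (punchIn (rootOr zero (toTree q)) k) (toTree q)

fromTree : BTree (Fin (suc e)) → Schröder (Fin e)
fromTree leaf = ε
fromTree (node l c r) with rootOr zero r ≟ c
... | yes _   = flat (fromTree l)
... | no r≢c  = lift (punchOut r≢c) (fromTree l) (fromTree r)

size-toTree : (p : Schröder (Fin e)) → size (toTree p) ≡ semilength p
size-toTree ε            = refl
size-toTree (flat p)     = cong suc (trans (ℕ.+-identityʳ _) (size-toTree p))
size-toTree (lift k p q) = cong suc (cong₂ _+_ (size-toTree p) (size-toTree q))

noSameRight-toTree : (p : Schröder (Fin e)) → noSameRight (toTree p) ≡ true
noSameRight-toTree ε = refl
noSameRight-toTree (flat p) rewrite noSameRight-toTree p = refl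
noSameRight-toTree (lift k p q)
  rewrite rootDiffers-punchIn (toTree q) k | noSameRight-toTree p | noSameRight-toTree q = refl

fromTree-toTree : (p : Schröder (Fin e)) → fromTree (toTree p) ≡ p
fromTree-toTree ε        = refl
fromTree-toTree (flat p) = cong flat (fromTree-toTree p)
fromTree-toTree (lift k p q) with rootOr zero (toTree q) ≟ punchIn (rootOr zero (toTree q)) k
... | yes r≡c = ⊥-elim (punchInᵢ≢i _ k (sym r≡c))
... | no r≢c = begin
  lift (punchOut r≢c) (fromTree (toTree p)) (fromTree (toTree q))
    ≡⟨ cong₂ (lift (punchOut r≢c)) (fromTree-toTree p) (fromTree-toTree q) ⟩
  lift (punchOut r≢c) p q
    ≡⟨ cong (λ j → lift j p q) (trans (punchOut-cong r refl) (punchOut-punchIn r)) ⟩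
  lift k p q ∎
  where
  r = rootOr zero (toTree q)

toTree-fromTree : (t : BTree (Fin (suc e))) → noSameRight t ≡ true → toTree (fromTree t) ≡ t
toTree-fromTree leaf _ = refl
toTree-fromTree (node l c r) ok with rootOr zero r ≟ c | noSameRight-node⁻ l c r ok
... | yes r≡c | differs , okl , _ with rootOr≡⇒leaf r differs r≡c
...   | refl , refl = cong (λ l′ → node l′ zero leaf) (toTree-fromTree l okl)
toTree-fromTree (node l c r) ok | no r≢c | _ , okl , okr
  rewrite toTree-fromTree l okl | toTree-fromTree r okr = cong (λ c′ → node l c′ r) (punchIn-punchOut r≢c)

Schröder↔T : ∀ n → Σ (Schröder (Fin e)) (λ p → semilength p ≡ n) ↔ T (suc e) n
Schröder↔T n = mk↔ₛ′ to from to∘from from∘to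
  where
  to : Σ (Schröder (Fin e)) (λ p → semilength p ≡ n) → T (suc e) n
  to (p , len) = toTree p , trans (size-toTree p) len , noSameRight-toTree p

  from : T (suc e) n → Σ (Schröder (Fin e)) (λ p → semilength p ≡ n)
  from (t , sz , ok) = fromTree t , (begin
    semilength (fromTree t)    ≡⟨ size-toTree (fromTree t) ⟨
    size (toTree (fromTree t)) ≡⟨ cong size (toTree-fromTree t ok) ⟩
    size t                     ≡⟨ sz ⟩
    n                          ∎)

  to∘from : ∀ y → to (from y) ≡ y
  to∘from (t , _ , ok) =
    proj₁-injective ≡×≡-irrelevant (toTree-fromTree t ok)

  from∘to : ∀ x → from (to x) ≡ x
  from∘to (p , _) = proj₁-injective ℕ.≡-irrelevant (fromTree-toTree p)

mainTheorem3 : (d n : ℕ) → d ≥ 1 → S d n ⤖ T d n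
mainTheorem3 (suc e) n _ = ↔⇒⤖ (↔-trans (SchroderPath↔Schröder n) (Schröder↔T n))
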